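{- Let $\mathbf L$ be an implicative modal lattice satisfying $\Diamond a\le\Box\Diamond a$ and $\Diamond\Box a\le\Box a$ for all $a\in L$. Then in its canonical frame, for every nonempty filter $x$: $\boxminus\mathsf d(x)\subseteq\mathsf d(x)$ and $\boxminus x\subseteq\mathsf d(\boxminus x)$.
   Context: An implicative modal lattice is a bounded lattice $(L,\le,\wedge,\vee,0,1)$ with binary $\to$ and unary $\Box,\Diamond$ such that $(a\vee b)\to c=(a\to c)\wedge(b\to c)$, $a\to(b\wedge c)=(a\to b)\wedge(a\to c)$, $0\to a=1=a\to1$, $\Box(a\wedge b)=\Box a\wedge\Box b$, $\Box1=1$, $\Diamond(a\vee b)=\Diamond a\vee\Diamond b$, $\Diamond0=0$. In the canonical frame, points of sort $1$ are the nonempty lattice filters; for a filter $x$, $\boxminus x$ denotes the filter generated by $\{\Box a:a\in x\}$ and $\mathsf d(x)$ the filter generated by $\{\Diamond a:a\in x\}$. -}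

module Defs where

open import Level using (Level; _⊔_; suc)
open import Data.List using (List; []; _∷_)
open import Data.List.Relation.Unary.All using (All)
open import Data.Product using (Σ; ∃; _×_)
open import Relation.Binary.Lattice.Bundles using (BoundedLattice)

-- Since the paper's operations are functions on L, they respect _≈_.
record ImplicativeModalLattice (c ℓ₁ ℓ₂ : Level) : Set (suc (c ⊔ ℓ₁ ⊔ ℓ₂)) where
  field
    boundedLattice : BoundedLattice c ℓ₁ ℓ₂
  open BoundedLattice boundedLattice public
  infixr 5 _⇒_
  field
    _⇒_ : Carrier → Carrier → Carrier
    □   : Carrier → Carrier
    ◇   : Carrier → Carrier
    ⇒-cong : ∀ {a a′ b b′} → a ≈ a′ → b ≈ b′ → (a ⇒ b) ≈ (a′ ⇒ b′)
    □-cong : ∀ {a a′} → a ≈ a′ → □ a ≈ □ a′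
    ◇-cong : ∀ {a a′} → a ≈ a′ → ◇ a ≈ ◇ a′
    ⇒-∨ˡ : ∀ a b c → ((a ∨ b) ⇒ c) ≈ ((a ⇒ c) ∧ (b ⇒ c))
    ⇒-∧ʳ : ∀ a b c → (a ⇒ (b ∧ c)) ≈ ((a ⇒ b) ∧ (a ⇒ c))
    ⊥⇒   : ∀ a → (⊥ ⇒ a) ≈ ⊤
    ⇒⊤   : ∀ a → (a ⇒ ⊤) ≈ ⊤
    □-∧  : ∀ a b → □ (a ∧ b) ≈ (□ a ∧ □ b)
    □-⊤  : □ ⊤ ≈ ⊤
    ◇-∨  : ∀ a b → ◇ (a ∨ b) ≈ (◇ a ∨ ◇ b)
    ◇-⊥  : ◇ ⊥ ≈ ⊥

module _ {c ℓ₁ ℓ₂ : Level} (L : ImplicativeModalLattice c ℓ₁ ℓ₂) where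
  open ImplicativeModalLattice L

  Pred : (p : Level) → Set (c ⊔ suc p)
  Pred p = Carrier → Set p

  _⊆_ : ∀ {p q} → Pred p → Pred q → Set (c ⊔ p ⊔ q)
  S ⊆ T = ∀ {a} → S a → T a

  -- A nonempty lattice filter (a point of sort 1 of the canonical frame).
  record IsFilter {p : Level} (F : Pred p) : Set (c ⊔ ℓ₂ ⊔ p) where
    field
      nonempty : ∃ F
      upward   : ∀ {a b} → F a → a ≤ b → F b
      meet     : ∀ {a b} → F a → F b → F (a ∧ b)

  record Filter (p : Level) : Set (c ⊔ ℓ₂ ⊔ suc p) where
    field
      pred     : Pred p
      isFilter : IsFilter pred

  ⋀ : List Carrier → Carrier
  ⋀ []       = ⊤
  ⋀ (a ∷ as) = a ∧ ⋀ as

  ⟨_⟩ : ∀ {p} → Pred p → Pred (c ⊔ ℓ₂ ⊔ p)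
  ⟨ S ⟩ a = Σ (List Carrier) λ bs → All S bs × (⋀ bs ≤ a)

  image : ∀ {p} → (Carrier → Carrier) → Pred p → Pred (c ⊔ ℓ₁ ⊔ p)
  image f S b = Σ Carrier λ a → S a × (f a ≈ b)

  ⊟ : ∀ {p} → Pred p → Pred (c ⊔ ℓ₁ ⊔ ℓ₂ ⊔ p)
  ⊟ S = ⟨ image □ S ⟩

  𝖽 : ∀ {p} → Pred p → Pred (c ⊔ ℓ₁ ⊔ ℓ₂ ⊔ p)
  𝖽 S = ⟨ image ◇ S ⟩

{-# OPTIONS --safe #-}
-- Neither inclusion uses that x is a filter: both hold for any subset S of L,
-- and since the left-hand sides are generated filters it suffices to place
-- their generators. For ⊟ 𝖽 S ⊆ 𝖽 S: the generators ◇a of 𝖽 S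
-- satisfy b ≤ □ b, and since □ preserves finite meets so does every finite
-- meet of them; hence □ maps 𝖽 S into itself. For ⊟ S ⊆ 𝖽 (⊟ S): a generator
-- □a of ⊟ S lies above ◇□a, which is itself a generator of 𝖽 (⊟ S).
module Submission where

open import Defs
open import Level using (Level)
open import Data.Product using (_×_; _,_)
open import Data.List using ([]; _∷_; _++_)
open import Data.List.Relation.Unary.All as All using (All; []; _∷_)
open import Data.List.Relation.Unary.All.Properties using (++⁺)

module _ {c ℓ₁ ℓ₂ : Level} (L : ImplicativeModalLattice c ℓ₁ ℓ₂) where
  open ImplicativeModalLattice L
  open import Relation.Binary.Lattice.Properties.MeetSemilattice meetSemilattice
    using (∧-monotonic; ∧-assoc; y≤x⇒x∧y≈y)
  open import Relation.Binary.Reasoning.PartialOrder poset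

  □-mono : ∀ {a b} → a ≤ b → □ a ≤ □ b
  □-mono {a} {b} a≤b = begin
    □ a           ≈⟨ □-cong (Eq.sym (y≤x⇒x∧y≈y a≤b)) ⟩
    □ (b ∧ a)     ≈⟨ □-∧ b a ⟩
    □ b ∧ □ a     ≤⟨ x∧y≤x (□ b) (□ a) ⟩
    □ b           ∎

  ⋀-++ : ∀ as bs → ⋀ L (as ++ bs) ≤ ⋀ L as ∧ ⋀ L bs
  ⋀-++ []       bs = ∧-greatest (maximum _) refl
  ⋀-++ (a ∷ as) bs = begin
    a ∧ ⋀ L (as ++ bs)          ≤⟨ ∧-monotonic refl (⋀-++ as bs) ⟩
    a ∧ (⋀ L as ∧ ⋀ L bs)       ≈⟨ Eq.sym (∧-assoc a (⋀ L as) (⋀ L bs)) ⟩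
    (a ∧ ⋀ L as) ∧ ⋀ L bs       ∎

  module _ {p} {F : Pred L p} (isFilter : IsFilter L F) where
    open IsFilter isFilter

    filter-⊤ : F ⊤
    filter-⊤ with nonempty
    ... | a , a∈F = upward a∈F (maximum a)

    filter-⋀ : ∀ {as} → All F as → F (⋀ L as)
    filter-⋀ []           = filter-⊤
    filter-⋀ (a∈F ∷ as∈F) = meet a∈F (filter-⋀ as∈F)

  module _ {p} (S : Pred L p) where

    ⟨⟩-generator : _⊆_ L S (⟨_⟩ L S)
    ⟨⟩-generator {a} a∈S = a ∷ [] , a∈S ∷ [] , x∧y≤x a ⊤

    ⟨⟩-isFilter : IsFilter L (⟨_⟩ L S)
    ⟨⟩-isFilter = record
      { nonempty = ⊤ , [] , [] , refl
      ; upward   = λ { (as , as∈S , ⋀as≤a) a≤b → as , as∈S , trans ⋀as≤a a≤b }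
      ; meet     = λ { (as , as∈S , ⋀as≤a) (bs , bs∈S , ⋀bs≤b) →
                       as ++ bs , ++⁺ as∈S bs∈S
                     , trans (⋀-++ as bs) (∧-monotonic ⋀as≤a ⋀bs≤b) }
      }

    ⟨⟩-least : ∀ {q} {F : Pred L q} → IsFilter L F → _⊆_ L S F → _⊆_ L (⟨_⟩ L S) F
    ⟨⟩-least isFilter S⊆F (as , as∈S , ⋀as≤a) =
      IsFilter.upward isFilter (filter-⋀ isFilter (All.map S⊆F as∈S)) ⋀as≤a

  □-Postfixed : Pred L ℓ₂
  □-Postfixed a = a ≤ □ a

  □-postfixed-⋀ : ∀ {as} → All □-Postfixed as → □-Postfixed (⋀ L as)
  □-postfixed-⋀ []                      = reflexive (Eq.sym □-⊤)
  □-postfixed-⋀ {a ∷ as} (a≤□a ∷ as≤□as) = begin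
    a ∧ ⋀ L as        ≤⟨ ∧-monotonic a≤□a (□-postfixed-⋀ as≤□as) ⟩
    □ a ∧ □ (⋀ L as)  ≈⟨ Eq.sym (□-∧ a (⋀ L as)) ⟩
    □ (a ∧ ⋀ L as)    ∎

  ⟨⟩-□-closed : ∀ {p} {S : Pred L p} → _⊆_ L S □-Postfixed →
                _⊆_ L (image L □ (⟨_⟩ L S)) (⟨_⟩ L S)
  ⟨⟩-□-closed S⊆□-Postfixed {b} (a , (as , as∈S , ⋀as≤a) , □a≈b) =
    as , as∈S , (begin
      ⋀ L as      ≤⟨ □-postfixed-⋀ (All.map S⊆□-Postfixed as∈S) ⟩
      □ (⋀ L as)  ≤⟨ □-mono ⋀as≤a ⟩
      □ a         ≈⟨ □a≈b ⟩
      b           ∎)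

  ◇-image-□-postfixed : ∀ {p} {S : Pred L p} → (∀ a → ◇ a ≤ □ (◇ a)) →
                        _⊆_ L (image L ◇ S) □-Postfixed
  ◇-image-□-postfixed ◇≤□◇ {b} (a , _ , ◇a≈b) = begin
    b          ≈⟨ Eq.sym ◇a≈b ⟩
    ◇ a        ≤⟨ ◇≤□◇ a ⟩
    □ (◇ a)    ≈⟨ □-cong ◇a≈b ⟩
    □ b        ∎

  ∈𝖽-if-◇-deflates : ∀ {p} {S : Pred L p} {b} → S b → ◇ b ≤ b → 𝖽 L S b
  ∈𝖽-if-◇-deflates {S = S} {b} b∈S ◇b≤b =
    IsFilter.upward (⟨⟩-isFilter (image L ◇ S))
      (⟨⟩-generator (image L ◇ S) (b , b∈S , Eq.refl)) ◇b≤b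

  ⊟𝖽⊆𝖽 : (∀ a → ◇ a ≤ □ (◇ a)) → ∀ {p} (S : Pred L p) → _⊆_ L (⊟ L (𝖽 L S)) (𝖽 L S)
  ⊟𝖽⊆𝖽 ◇≤□◇ S =
    ⟨⟩-least (image L □ (𝖽 L S)) (⟨⟩-isFilter (image L ◇ S))
      (⟨⟩-□-closed (◇-image-□-postfixed ◇≤□◇))

  ⊟⊆𝖽⊟ : (∀ a → ◇ (□ a) ≤ □ a) → ∀ {p} (S : Pred L p) → _⊆_ L (⊟ L S) (𝖽 L (⊟ L S))
  ⊟⊆𝖽⊟ ◇□≤□ S = ⟨⟩-least (image L □ S) (⟨⟩-isFilter (image L ◇ (⊟ L S))) □-image⊆𝖽⊟
    where
    □-image⊆𝖽⊟ : _⊆_ L (image L □ S) (𝖽 L (⊟ L S))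
    □-image⊆𝖽⊟ {b} b∈□S@(a , _ , □a≈b) =
      ∈𝖽-if-◇-deflates (⟨⟩-generator (image L □ S) b∈□S) (begin
        ◇ b        ≈⟨ ◇-cong (Eq.sym □a≈b) ⟩
        ◇ (□ a)    ≤⟨ ◇□≤□ a ⟩
        □ a        ≈⟨ □a≈b ⟩
        b          ∎)

proposition6p6 : {c ℓ₁ ℓ₂ p : Level} (L : ImplicativeModalLattice c ℓ₁ ℓ₂) →
    let open ImplicativeModalLattice L in
    (∀ a → ◇ a ≤ □ (◇ a)) →
    (∀ a → ◇ (□ a) ≤ □ a) →
    (x : Filter L p) →
    (_⊆_ L (⊟ L (𝖽 L (Filter.pred x))) (𝖽 L (Filter.pred x)))
    × (_⊆_ L (⊟ L (Filter.pred x)) (𝖽 L (⊟ L (Filter.pred x))))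
proposition6p6 L ◇≤□◇ ◇□≤□ x = ⊟𝖽⊆𝖽 L ◇≤□◇ (Filter.pred x) , ⊟⊆𝖽⊟ L ◇□≤□ (Filter.pred x)
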